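{- Each bi-liberalizable symmetric monoidal closed category (BiLSMCC) $\mathcal{C}$ gives a semantics of LLK$^-$ in $\sharp\mathcal{C}$, interpreting proofs of $A_1, \dots, A_m \vdash B_1, \dots, B_n$ as morphisms $A_1 \otimes \dots \otimes A_m \to B_1 ⅋ \dots ⅋ B_n$ in $\sharp\mathcal{C}$.
   Context: A new-Seely category (NSC) is a symmetric monoidal closed category $(\mathcal{C}, \otimes, \top, \multimap)$ with finite products $(1, \&)$ and a comonad $! = (!, \epsilon, \delta)$ such that the canonical adjunction between $\mathcal{C}$ and the co-Kleisli category $\mathcal{C}_!$ is monoidal, with natural isomorphisms $\top \cong !1$, $!A \otimes !B \cong !(A \& B)$; a backward-liberalizable (BwL) SMC is the same without $\multimap$. A forward-liberalizable (FwL) SMC $(\mathcal{C}, ⅋, \bot)$ has finite coproducts $(0,\oplus)$, a monad $? = (?, \eta, \mu)$ with monoidal canonical Kleisli adjunction, and natural isomorphisms $?0 \cong \bot$, $?(A \oplus B) \cong ?A ⅋ ?B$. A BiLSMCC is an NSC $\mathcal{C} = (\mathcal{C}, \otimes, \top, \multimap, !)$ with weak finite coproducts $(0, \oplus)$, equipped with: a lluf (same objects) sub-BwLSMC $\sharp\mathcal{C}$ and a triple $(⅋, \bot, ?)$ such that $\top$ is terminal and $\bot$ initial in $\sharp\mathcal{C}$, $\sharp\mathcal{C}(A, \bot) = \mathcal{C}(A, \bot)$, $\sharp\mathcal{C}(\top, B) = \mathcal{C}(\top, B)$, and $(\sharp \mathcal{C}, ⅋, \bot, ?)$ is FwL with finite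 coproducts $(0, \oplus)$; natural transformations in $\sharp\mathcal{C}$: $\Omega_{A,B,C} : A \otimes (B ⅋ C) \to (A \otimes B) ⅋ C$, $\Sigma_{A,B} : !(A ⅋ ?B) \to !A ⅋ ?B$, $\Pi_{A,B} : !A \otimes ?B \to ?(!A ⅋ B)$; natural isomorphisms in $\sharp\mathcal{C}$: $A ⅋ \top \cong \top$, $A \multimap B \cong \neg A ⅋ B$, $?(A \multimap B) \cong !A \multimap ?B$, $\neg A \oplus \neg B \cong \neg(A \& B)$ (with $\neg A = A \multimap \bot$); and a distributive law $\Upsilon : !? \Rightarrow ?!$ of $!$ over $?$. LLK$^-$ is the two-sided sequent calculus for propositional linear logic without linear negation ($\top$ unit of $\otimes$, $\bot$ unit of $⅋$, plus $1, 0, \&, \oplus, \multimap, !, ?$), obtained from the standard calculus LLK by restricting Cut to Cut$^-$ (from $\Delta \vdash B$, $\Delta', B \vdash \Gamma'$ infer $\Delta, \Delta' \vdash \Gamma'$), $\otimes$R to $\otimes$R$^-$ (from $\Delta_1 \vdash B_1$, $\Delta_2 \vdash B_2$ infer $\Delta_1, \Delta_2 \vdash B_1 \otimes B_2$), $⅋$L to $⅋$L$^-$ (from $A_1 \vdash \Gamma_1$, $A_2 \vdash \Gamma_2$ infer $A_1 ⅋ A_2 \vdash \Gamma_1, \Gamma_2$), $\&$R to $\&$R$^-$ (empty right context), $\oplus$L to $\oplus$L$^-$ (single formula on the left), $\multimap$R to $\multimap$R$^-$ (from $A \vdash B, \Gamma$ infer $\vdash A \multimap B, \Gamma$), and adding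 distribution rules: from $\Delta, ?!A \vdash \Gamma$ infer $\Delta, !?A \vdash \Gamma$; from $\Delta \vdash !?B, \Gamma$ infer $\Delta \vdash ?!B, \Gamma$; from $\Delta, (A \otimes B) ⅋ C \vdash \Gamma$ infer $\Delta, A, B ⅋ C \vdash \Gamma$; from $\Delta \vdash A \otimes (B ⅋ C), \Gamma$ infer $\Delta \vdash A \otimes B, C, \Gamma$. -}

module Defs where

open import Level using (Level; _⊔_) renaming (suc to lsuc)
open import Data.Nat using (ℕ)
open import Data.Product using (Σ; _,_; proj₁; proj₂)
open import Data.List using (List; []; _∷_; _++_; [_]; map)
open import Data.List.Relation.Binary.Permutation.Propositional using (_↭_)
open import Relation.Binary.Structures using (IsEquivalence)

record Category (o ℓ e : Level) : Set (lsuc (o ⊔ ℓ ⊔ e)) where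
  infix  4 _≈_
  infixr 9 _∘_
  field
    Obj : Set o
    _⇒_ : Obj → Obj → Set ℓ
    _≈_ : ∀ {A B} → A ⇒ B → A ⇒ B → Set e
    id  : ∀ {A} → A ⇒ A
    _∘_ : ∀ {A B C} → B ⇒ C → A ⇒ B → A ⇒ C
    ≈-equiv   : ∀ {A B} → IsEquivalence (_≈_ {A} {B})
    assoc     : ∀ {A B C D} {f : A ⇒ B} {g : B ⇒ C} {h : C ⇒ D} →
                (h ∘ g) ∘ f ≈ h ∘ (g ∘ f)
    identityˡ : ∀ {A B} {f : A ⇒ B} → id ∘ f ≈ f
    identityʳ : ∀ {A B} {f : A ⇒ B} → f ∘ id ≈ f
    ∘-resp-≈  : ∀ {A B C} {f h : B ⇒ C} {g i : A ⇒ B} →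
                f ≈ h → g ≈ i → f ∘ g ≈ h ∘ i

op : ∀ {o ℓ e} → Category o ℓ e → Category o ℓ e
op C = record
  { Obj = Obj
  ; _⇒_ = λ A B → B ⇒ A
  ; _≈_ = _≈_
  ; id = id
  ; _∘_ = λ f g → g ∘ f
  ; ≈-equiv = ≈-equiv
  ; assoc = IsEquivalence.sym ≈-equiv assoc
  ; identityˡ = identityʳ
  ; identityʳ = identityˡ
  ; ∘-resp-≈ = λ p q → ∘-resp-≈ q p
  }
  where open Category C

module _ {o ℓ e} (C : Category o ℓ e) where
  open Category C

  record Monoidal : Set (o ⊔ ℓ ⊔ e) where
    infixr 10 _⊗₀_ _⊗₁_
    field
      _⊗₀_ : Obj → Obj → Obj
      _⊗₁_ : ∀ {A B X Y} → A ⇒ B → X ⇒ Y → (A ⊗₀ X) ⇒ (B ⊗₀ Y)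
      unit : Obj
      ⊗-id   : ∀ {A B} → id {A} ⊗₁ id {B} ≈ id
      ⊗-∘    : ∀ {A B D X Y Z} {f : B ⇒ D} {g : A ⇒ B} {h : Y ⇒ Z} {i : X ⇒ Y} →
               (f ∘ g) ⊗₁ (h ∘ i) ≈ (f ⊗₁ h) ∘ (g ⊗₁ i)
      ⊗-resp : ∀ {A B X Y} {f g : A ⇒ B} {h i : X ⇒ Y} →
               f ≈ g → h ≈ i → f ⊗₁ h ≈ g ⊗₁ i
      α⇒ : ∀ {A B D} → ((A ⊗₀ B) ⊗₀ D) ⇒ (A ⊗₀ (B ⊗₀ D))
      α⇐ : ∀ {A B D} → (A ⊗₀ (B ⊗₀ D)) ⇒ ((A ⊗₀ B) ⊗₀ D)
      l⇒ : ∀ {A} → (unit ⊗₀ A) ⇒ A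
      l⇐ : ∀ {A} → A ⇒ (unit ⊗₀ A)
      r⇒ : ∀ {A} → (A ⊗₀ unit) ⇒ A
      r⇐ : ∀ {A} → A ⇒ (A ⊗₀ unit)
      α-isoˡ : ∀ {A B D} → α⇐ {A} {B} {D} ∘ α⇒ ≈ id
      α-isoʳ : ∀ {A B D} → α⇒ {A} {B} {D} ∘ α⇐ ≈ id
      l-isoˡ : ∀ {A} → l⇐ {A} ∘ l⇒ ≈ id
      l-isoʳ : ∀ {A} → l⇒ {A} ∘ l⇐ ≈ id
      r-isoˡ : ∀ {A} → r⇐ {A} ∘ r⇒ ≈ id
      r-isoʳ : ∀ {A} → r⇒ {A} ∘ r⇐ ≈ id
      α-nat : ∀ {A A' B B' D D'} {f : A ⇒ A'} {g : B ⇒ B'} {h : D ⇒ D'} →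
              α⇒ ∘ ((f ⊗₁ g) ⊗₁ h) ≈ (f ⊗₁ (g ⊗₁ h)) ∘ α⇒
      l-nat : ∀ {A B} {f : A ⇒ B} → l⇒ ∘ (id ⊗₁ f) ≈ f ∘ l⇒
      r-nat : ∀ {A B} {f : A ⇒ B} → r⇒ ∘ (f ⊗₁ id) ≈ f ∘ r⇒
      triangle : ∀ {A B} → (id {A} ⊗₁ l⇒ {B}) ∘ α⇒ ≈ r⇒ ⊗₁ id
      pentagon : ∀ {A B D E} →
                 (id {A} ⊗₁ α⇒ {B} {D} {E}) ∘ (α⇒ ∘ (α⇒ ⊗₁ id)) ≈ α⇒ ∘ α⇒

  record Symmetric (M : Monoidal) : Set (o ⊔ ℓ ⊔ e) where
    open Monoidal M
    field
      σ : ∀ {A B} → (A ⊗₀ B) ⇒ (B ⊗₀ A)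
      σ-nat : ∀ {A A' B B'} {f : A ⇒ A'} {g : B ⇒ B'} →
              σ ∘ (f ⊗₁ g) ≈ (g ⊗₁ f) ∘ σ
      σ-inv : ∀ {A B} → σ {B} {A} ∘ σ {A} {B} ≈ id
      hexagon : ∀ {A B D} →
                α⇒ ∘ (σ ∘ α⇒) ≈ (id {B} ⊗₁ σ {A} {D}) ∘ (α⇒ ∘ (σ ⊗₁ id))

  record Closed (M : Monoidal) : Set (o ⊔ ℓ ⊔ e) where
    open Monoidal M
    infixr 8 _⊸_
    field
      _⊸_ : Obj → Obj → Obj
      ev  : ∀ {A B} → ((A ⊸ B) ⊗₀ A) ⇒ B
      Λ   : ∀ {X A B} → (X ⊗₀ A) ⇒ B → X ⇒ (A ⊸ B)
      Λ-β : ∀ {X A B} {f : (X ⊗₀ A) ⇒ B} → ev ∘ (Λ f ⊗₁ id) ≈ f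
      Λ-unique : ∀ {X A B} {f : (X ⊗₀ A) ⇒ B} {g : X ⇒ (A ⊸ B)} →
                 ev ∘ (g ⊗₁ id) ≈ f → g ≈ Λ f
    _⊸₁_ : ∀ {A A' B B'} → A' ⇒ A → B ⇒ B' → (A ⊸ B) ⇒ (A' ⊸ B')
    f ⊸₁ g = Λ (g ∘ (ev ∘ (id ⊗₁ f)))

  record Products : Set (o ⊔ ℓ ⊔ e) where
    infixr 11 _&_
    field
      one : Obj
      !   : ∀ {A} → A ⇒ one
      !-unique : ∀ {A} {f : A ⇒ one} → f ≈ !
      _&_ : Obj → Obj → Obj
      π₁ : ∀ {A B} → (A & B) ⇒ A
      π₂ : ∀ {A B} → (A & B) ⇒ B
      ⟨_,_⟩ : ∀ {X A B} → X ⇒ A → X ⇒ B → X ⇒ (A & B)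
      π₁-β : ∀ {X A B} {f : X ⇒ A} {g : X ⇒ B} → π₁ ∘ ⟨ f , g ⟩ ≈ f
      π₂-β : ∀ {X A B} {f : X ⇒ A} {g : X ⇒ B} → π₂ ∘ ⟨ f , g ⟩ ≈ g
      ⟨⟩-unique : ∀ {X A B} {f : X ⇒ A} {g : X ⇒ B} {h : X ⇒ (A & B)} →
                  π₁ ∘ h ≈ f → π₂ ∘ h ≈ g → h ≈ ⟨ f , g ⟩
    α& : ∀ {A B D} → ((A & B) & D) ⇒ (A & (B & D))
    α& = ⟨ π₁ ∘ π₁ , ⟨ π₂ ∘ π₁ , π₂ ⟩ ⟩
    l& : ∀ {A} → (one & A) ⇒ A
    l& = π₂
    r& : ∀ {A} → (A & one) ⇒ A
    r& = π₁
    σ& : ∀ {A B} → (A & B) ⇒ (B & A)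
    σ& = ⟨ π₂ , π₁ ⟩
    _&₁_ : ∀ {A A' B B'} → A ⇒ A' → B ⇒ B' → (A & B) ⇒ (A' & B')
    f &₁ g = ⟨ f ∘ π₁ , g ∘ π₂ ⟩

  record Comonad : Set (o ⊔ ℓ ⊔ e) where
    field
      F₀ : Obj → Obj
      F₁ : ∀ {A B} → A ⇒ B → F₀ A ⇒ F₀ B
      F-id : ∀ {A} → F₁ (id {A}) ≈ id
      F-∘  : ∀ {A B D} {f : B ⇒ D} {g : A ⇒ B} → F₁ (f ∘ g) ≈ F₁ f ∘ F₁ g
      F-resp : ∀ {A B} {f g : A ⇒ B} → f ≈ g → F₁ f ≈ F₁ g
      ε : ∀ {A} → F₀ A ⇒ A
      δ : ∀ {A} → F₀ A ⇒ F₀ (F₀ A)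
      ε-nat : ∀ {A B} {f : A ⇒ B} → ε ∘ F₁ f ≈ f ∘ ε
      δ-nat : ∀ {A B} {f : A ⇒ B} → δ ∘ F₁ f ≈ F₁ (F₁ f) ∘ δ
      εδ    : ∀ {A} → ε {F₀ A} ∘ δ {A} ≈ id
      Fεδ   : ∀ {A} → F₁ (ε {A}) ∘ δ ≈ id
      δδ    : ∀ {A} → δ {F₀ A} ∘ δ {A} ≈ F₁ δ ∘ δ
    -- co-Kleisli category C_! : a map A →! B is a map F₀ A ⇒ B in C.
    -- canonical functor C → C_!  (identity on objects)
    lift : ∀ {A B} → A ⇒ B → F₀ A ⇒ B
    lift f = f ∘ ε
    -- canonical functor C_! → C  (A ↦ F₀ A)
    Fk : ∀ {A B} → F₀ A ⇒ B → F₀ A ⇒ F₀ B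
    Fk f = F₁ f ∘ δ

  -- Liberalizability (with respect to a comonad): the canonical
  -- adjunction between C and the co-Kleisli category C_! is symmetric
  -- monoidal, (C_!, &, 1) carrying its cartesian structure, with the
  -- structure isomorphisms  ⊤ ≅ !1  and  !A ⊗ !B ≅ !(A & B) ; i.e. the
  -- left adjoint C_! → C (A ↦ !A) is strong symmetric monoidal via them.
  record Liberal (M : Monoidal) (S : Symmetric M) (P : Products)
                 (G : Comonad) : Set (o ⊔ ℓ ⊔ e) where
    open Monoidal M
    open Symmetric S
    open Products P
    open Comonad G
    field
      m₀  : unit ⇒ F₀ one
      m₀⁻ : F₀ one ⇒ unit
      m   : ∀ {A B} → (F₀ A ⊗₀ F₀ B) ⇒ F₀ (A & B)
      m⁻  : ∀ {A B} → F₀ (A & B) ⇒ (F₀ A ⊗₀ F₀ B)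
      m₀-isoˡ : m₀⁻ ∘ m₀ ≈ id
      m₀-isoʳ : m₀ ∘ m₀⁻ ≈ id
      m-isoˡ  : ∀ {A B} → m⁻ {A} {B} ∘ m ≈ id
      m-isoʳ  : ∀ {A B} → m {A} {B} ∘ m⁻ ≈ id
      -- naturality of m with respect to co-Kleisli maps
      m-nat : ∀ {A A' B B'} {f : F₀ A ⇒ A'} {g : F₀ B ⇒ B'} →
              Fk ⟨ f ∘ F₁ π₁ , g ∘ F₁ π₂ ⟩ ∘ m ≈ m ∘ (Fk f ⊗₁ Fk g)
      m-assoc : ∀ {A B D} →
                Fk (lift (α& {A} {B} {D})) ∘ (m ∘ (m ⊗₁ id)) ≈ m ∘ ((id ⊗₁ m) ∘ α⇒)
      m-unitˡ : ∀ {A} → Fk (lift (l& {A})) ∘ (m ∘ (m₀ ⊗₁ id)) ≈ l⇒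
      m-unitʳ : ∀ {A} → Fk (lift (r& {A})) ∘ (m ∘ (id ⊗₁ m₀)) ≈ r⇒
      m-sym   : ∀ {A B} → Fk (lift (σ& {A} {B})) ∘ m ≈ m ∘ σ

  record WeakCoproducts : Set (o ⊔ ℓ ⊔ e) where
    infixr 11 _⊕_
    field
      zero : Obj
      ¡    : ∀ {A} → zero ⇒ A
      _⊕_  : Obj → Obj → Obj
      inj₁ : ∀ {A B} → A ⇒ (A ⊕ B)
      inj₂ : ∀ {A B} → B ⇒ (A ⊕ B)
      copair : ∀ {A B X} → A ⇒ X → B ⇒ X → (A ⊕ B) ⇒ X
      inj₁-β : ∀ {A B X} {f : A ⇒ X} {g : B ⇒ X} → copair f g ∘ inj₁ ≈ f
      inj₂-β : ∀ {A B X} {f : A ⇒ X} {g : B ⇒ X} → copair f g ∘ inj₂ ≈ g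

-- New-Seely categories (NSC)

record NSC (o ℓ e : Level) : Set (lsuc (o ⊔ ℓ ⊔ e)) where
  field
    cat      : Category o ℓ e
    monoidal : Monoidal cat
    symm     : Symmetric cat monoidal
    closed   : Closed cat monoidal
    products : Products cat
    bang     : Comonad cat
    liberal  : Liberal cat monoidal symm products bang

-- Lluf subcategories closed under the BwL-structure of an NSC
-- ("sub-BwLSMC"), together with closure under ⊸

module _ {o ℓ e} (N : NSC o ℓ e) where
  open NSC N
  open Category cat
  open Monoidal monoidal
  open Symmetric symm
  open Closed closed
  open Products products
  open Comonad bang
  open Liberal liberal

  record SharpSub : Set (o ⊔ lsuc ℓ ⊔ e) where
    field
      ♯ : ∀ {A B} → A ⇒ B → Set ℓ
      ♯-resp : ∀ {A B} {f g : A ⇒ B} → f ≈ g → ♯ f → ♯ g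
      ♯-id   : ∀ {A} → ♯ (id {A})
      ♯-∘    : ∀ {A B D} {f : B ⇒ D} {g : A ⇒ B} → ♯ f → ♯ g → ♯ (f ∘ g)
      ♯-⊗₁ : ∀ {A B X Y} {f : A ⇒ B} {g : X ⇒ Y} → ♯ f → ♯ g → ♯ (f ⊗₁ g)
      ♯-α⇒ : ∀ {A B D} → ♯ (α⇒ {A} {B} {D})
      ♯-α⇐ : ∀ {A B D} → ♯ (α⇐ {A} {B} {D})
      ♯-l⇒ : ∀ {A} → ♯ (l⇒ {A})
      ♯-l⇐ : ∀ {A} → ♯ (l⇐ {A})
      ♯-r⇒ : ∀ {A} → ♯ (r⇒ {A})
      ♯-r⇐ : ∀ {A} → ♯ (r⇐ {A})
      ♯-σ  : ∀ {A B} → ♯ (σ {A} {B})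
      ♯-!  : ∀ {A} → ♯ (! {A})
      ♯-π₁ : ∀ {A B} → ♯ (π₁ {A} {B})
      ♯-π₂ : ∀ {A B} → ♯ (π₂ {A} {B})
      ♯-⟨⟩ : ∀ {X A B} {f : X ⇒ A} {g : X ⇒ B} → ♯ f → ♯ g → ♯ ⟨ f , g ⟩
      ♯-F₁ : ∀ {A B} {f : A ⇒ B} → ♯ f → ♯ (F₁ f)
      ♯-ε  : ∀ {A} → ♯ (ε {A})
      ♯-δ  : ∀ {A} → ♯ (δ {A})
      ♯-m₀  : ♯ m₀
      ♯-m₀⁻ : ♯ m₀⁻
      ♯-m   : ∀ {A B} → ♯ (m {A} {B})
      ♯-m⁻  : ∀ {A B} → ♯ (m⁻ {A} {B})
      -- ⊸ acts on ♯-maps (needed for natural transformations in ♯C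
      -- involving ⊸ and ¬ to make sense)
      ♯-⊸₁ : ∀ {A A' B B'} {f : A' ⇒ A} {g : B ⇒ B'} → ♯ f → ♯ g → ♯ (f ⊸₁ g)

  module _ (S : SharpSub) where
    open SharpSub S
    ♯Cat : Category o ℓ e
    ♯Cat = record
      { Obj = Obj
      ; _⇒_ = λ A B → Σ (A ⇒ B) ♯
      ; _≈_ = λ f g → proj₁ f ≈ proj₁ g
      ; id = id , ♯-id
      ; _∘_ = λ f g → (proj₁ f ∘ proj₁ g) , ♯-∘ (proj₂ f) (proj₂ g)
      ; ≈-equiv = record { refl = IsEquivalence.refl ≈-equiv
                         ; sym = IsEquivalence.sym ≈-equiv
                         ; trans = IsEquivalence.trans ≈-equiv }
      ; assoc = assoc
      ; identityˡ = identityˡ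
      ; identityʳ = identityʳ
      ; ∘-resp-≈ = ∘-resp-≈
      }

  -- (0, ⊕) being finite coproducts in ♯C, with the injections of the
  -- weak coproducts of C
  module _ (W : WeakCoproducts cat) (S : SharpSub) where
    open WeakCoproducts W
    open SharpSub S
    open Category (♯Cat S) using () renaming (_⇒_ to _⇒♯_; _∘_ to _∘♯_; _≈_ to _≈♯_)
    record SharpCoproducts : Set (o ⊔ ℓ ⊔ e) where
      field
        ♯-inj₁ : ∀ {A B} → ♯ (inj₁ {A} {B})
        ♯-inj₂ : ∀ {A B} → ♯ (inj₂ {A} {B})
        ♯¡ : ∀ {A} → zero ⇒♯ A
        ♯¡-unique : ∀ {A} {f : zero ⇒♯ A} → f ≈♯ ♯¡
        ♯copair : ∀ {A B X} → A ⇒♯ X → B ⇒♯ X → (A ⊕ B) ⇒♯ X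
        ♯inj₁-β : ∀ {A B X} {f : A ⇒♯ X} {g : B ⇒♯ X} →
                  ♯copair f g ∘♯ (inj₁ , ♯-inj₁) ≈♯ f
        ♯inj₂-β : ∀ {A B X} {f : A ⇒♯ X} {g : B ⇒♯ X} →
                  ♯copair f g ∘♯ (inj₂ , ♯-inj₂) ≈♯ g
        ♯[]-unique : ∀ {A B X} {f : A ⇒♯ X} {g : B ⇒♯ X} {h : (A ⊕ B) ⇒♯ X} →
                     h ∘♯ (inj₁ , ♯-inj₁) ≈♯ f → h ∘♯ (inj₂ , ♯-inj₂) ≈♯ g →
                     h ≈♯ ♯copair f g

    coprodAsOpProducts : SharpCoproducts → Products (op (♯Cat S))
    coprodAsOpProducts SC = record
      { one = zero
      ; ! = ♯¡
      ; !-unique = λ {A} {f} → ♯¡-unique {A} {f}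
      ; _&_ = _⊕_
      ; π₁ = inj₁ , ♯-inj₁
      ; π₂ = inj₂ , ♯-inj₂
      ; ⟨_,_⟩ = ♯copair
      ; π₁-β = ♯inj₁-β
      ; π₂-β = ♯inj₂-β
      ; ⟨⟩-unique = λ {X} {A} {B} {f} {g} {h} → ♯[]-unique {A} {B} {X} {f} {g} {h}
      }
      where open SharpCoproducts SC

    -- forward-liberalizable structure (⅋, ⊥, ?) on ♯C with coproducts
    -- (0, ⊕): the exact dual of a BwL structure, i.e. a BwL structure on
    -- (♯C)^op.  The ⊗ of (♯C)^op is ⅋, its unit ⊥, its comonad the monad
    -- ?, its co-Kleisli category the Kleisli category of ?; the
    -- liberalizing isomorphisms become ?(A ⊕ B) ≅ ?A ⅋ ?B and ?0 ≅ ⊥.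
    record FwLPart (SC : SharpCoproducts) : Set (o ⊔ ℓ ⊔ e) where
      field
        par     : Monoidal (op (♯Cat S))
        parSym  : Symmetric (op (♯Cat S)) par
        quest   : Comonad (op (♯Cat S))
        fwl     : Liberal (op (♯Cat S)) par parSym (coprodAsOpProducts SC) quest

module BiOps {o ℓ e} (N : NSC o ℓ e) (W : WeakCoproducts (NSC.cat N))
             (S : SharpSub N) (SC : SharpCoproducts N W S)
             (FP : FwLPart N W S SC) where
  open NSC N
  open Category cat
  open Monoidal monoidal
  open Closed closed
  open Products products
  open Comonad bang
  open WeakCoproducts W
  open SharpSub S
  open SharpCoproducts SC
  open FwLPart FP

  open Category (♯Cat N S) public using ()
    renaming (_⇒_ to _⇒♯_; _∘_ to _∘♯_; _≈_ to _≈♯_; id to id♯)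

  infixr 10 _⊗♯_ _⅋_ _⅋♯_
  _⊗♯_ : ∀ {A B X Y} → A ⇒♯ B → X ⇒♯ Y → (A ⊗₀ X) ⇒♯ (B ⊗₀ Y)
  f ⊗♯ g = (proj₁ f ⊗₁ proj₁ g) , ♯-⊗₁ (proj₂ f) (proj₂ g)
  _&♯_ : ∀ {A A' B B'} → A ⇒♯ A' → B ⇒♯ B' → (A & B) ⇒♯ (A' & B')
  f &♯ g = (proj₁ f &₁ proj₁ g) ,
           ♯-⟨⟩ (♯-∘ (proj₂ f) ♯-π₁) (♯-∘ (proj₂ g) ♯-π₂)
  !♯ : ∀ {A B} → A ⇒♯ B → F₀ A ⇒♯ F₀ B
  !♯ f = F₁ (proj₁ f) , ♯-F₁ (proj₂ f)
  ε♯ : ∀ {A} → F₀ A ⇒♯ A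
  ε♯ = ε , ♯-ε
  δ♯ : ∀ {A} → F₀ A ⇒♯ F₀ (F₀ A)
  δ♯ = δ , ♯-δ
  _⊸♯_ : ∀ {A A' B B'} → A' ⇒♯ A → B ⇒♯ B' → (A ⊸ B) ⇒♯ (A' ⊸ B')
  f ⊸♯ g = (proj₁ f ⊸₁ proj₁ g) , ♯-⊸₁ (proj₂ f) (proj₂ g)

  _⅋_ : Obj → Obj → Obj
  _⅋_ = Monoidal._⊗₀_ par
  ⊥ : Obj
  ⊥ = Monoidal.unit par
  _⅋♯_ : ∀ {A B X Y} → A ⇒♯ B → X ⇒♯ Y → (A ⅋ X) ⇒♯ (B ⅋ Y)
  f ⅋♯ g = Monoidal._⊗₁_ par f g
  ⁇ : Obj → Obj
  ⁇ = Comonad.F₀ quest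
  ⁇♯ : ∀ {A B} → A ⇒♯ B → ⁇ A ⇒♯ ⁇ B
  ⁇♯ = Comonad.F₁ quest
  η♯ : ∀ {A} → A ⇒♯ ⁇ A
  η♯ = Comonad.ε quest
  μ♯ : ∀ {A} → ⁇ (⁇ A) ⇒♯ ⁇ A
  μ♯ = Comonad.δ quest
  _⊕♯_ : ∀ {A A' B B'} → A ⇒♯ A' → B ⇒♯ B' → (A ⊕ B) ⇒♯ (A' ⊕ B')
  f ⊕♯ g = ♯copair ((inj₁ , ♯-inj₁) ∘♯ f) ((inj₂ , ♯-inj₂) ∘♯ g)
  ¬ : Obj → Obj
  ¬ A = A ⊸ ⊥
  ¬♯ : ∀ {A A'} → A' ⇒♯ A → ¬ A ⇒♯ ¬ A'
  ¬♯ f = f ⊸♯ id♯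

module _ {o ℓ e} (N : NSC o ℓ e) (W : WeakCoproducts (NSC.cat N))
         (S : SharpSub N) (SC : SharpCoproducts N W S)
         (FP : FwLPart N W S SC) where
  open NSC N
  open Category cat
  open Monoidal monoidal
  open Closed closed
  open Products products
  open Comonad bang
  open WeakCoproducts W
  open SharpSub S
  open BiOps N W S SC FP

  record BiAxioms : Set (o ⊔ ℓ ⊔ e) where
    field
      ⊤-term        : ∀ {A} → A ⇒♯ unit
      ⊤-term-unique : ∀ {A} {f : A ⇒♯ unit} → f ≈♯ ⊤-term
      ⊥-init        : ∀ {A} → ⊥ ⇒♯ A
      ⊥-init-unique : ∀ {A} {f : ⊥ ⇒♯ A} → f ≈♯ ⊥-init
      ♯-into-⊥   : ∀ {A} (f : A ⇒ ⊥) → ♯ f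
      ♯-from-⊤   : ∀ {B} (f : unit ⇒ B) → ♯ f
      Ω : ∀ {A B D} → (A ⊗₀ (B ⅋ D)) ⇒♯ ((A ⊗₀ B) ⅋ D)
      Ω-nat : ∀ {A A' B B' D D'} {f : A ⇒♯ A'} {g : B ⇒♯ B'} {h : D ⇒♯ D'} →
              Ω ∘♯ (f ⊗♯ (g ⅋♯ h)) ≈♯ ((f ⊗♯ g) ⅋♯ h) ∘♯ Ω
      Sig : ∀ {A B} → F₀ (A ⅋ ⁇ B) ⇒♯ (F₀ A ⅋ ⁇ B)
      Sig-nat : ∀ {A A' B B'} {f : A ⇒♯ A'} {g : B ⇒♯ B'} →
                Sig ∘♯ !♯ (f ⅋♯ ⁇♯ g) ≈♯ (!♯ f ⅋♯ ⁇♯ g) ∘♯ Sig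
      Pi : ∀ {A B} → (F₀ A ⊗₀ ⁇ B) ⇒♯ ⁇ (F₀ A ⅋ B)
      Pi-nat : ∀ {A A' B B'} {f : A ⇒♯ A'} {g : B ⇒♯ B'} →
               Pi ∘♯ (!♯ f ⊗♯ ⁇♯ g) ≈♯ ⁇♯ (!♯ f ⅋♯ g) ∘♯ Pi
      pt  : ∀ {A} → (A ⅋ unit) ⇒♯ unit
      pt⁻ : ∀ {A} → unit ⇒♯ (A ⅋ unit)
      pt-isoˡ : ∀ {A} → pt⁻ {A} ∘♯ pt ≈♯ id♯
      pt-isoʳ : ∀ {A} → pt {A} ∘♯ pt⁻ ≈♯ id♯
      pt-nat  : ∀ {A A'} {f : A ⇒♯ A'} → pt ∘♯ (f ⅋♯ id♯) ≈♯ pt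
      ln  : ∀ {A B} → (A ⊸ B) ⇒♯ (¬ A ⅋ B)
      ln⁻ : ∀ {A B} → (¬ A ⅋ B) ⇒♯ (A ⊸ B)
      ln-isoˡ : ∀ {A B} → ln⁻ {A} {B} ∘♯ ln ≈♯ id♯
      ln-isoʳ : ∀ {A B} → ln {A} {B} ∘♯ ln⁻ ≈♯ id♯
      ln-nat  : ∀ {A A' B B'} {f : A' ⇒♯ A} {g : B ⇒♯ B'} →
                ln ∘♯ (f ⊸♯ g) ≈♯ (¬♯ f ⅋♯ g) ∘♯ ln
      qi  : ∀ {A B} → ⁇ (A ⊸ B) ⇒♯ (F₀ A ⊸ ⁇ B)
      qi⁻ : ∀ {A B} → (F₀ A ⊸ ⁇ B) ⇒♯ ⁇ (A ⊸ B)
      qi-isoˡ : ∀ {A B} → qi⁻ {A} {B} ∘♯ qi ≈♯ id♯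
      qi-isoʳ : ∀ {A B} → qi {A} {B} ∘♯ qi⁻ ≈♯ id♯
      qi-nat  : ∀ {A A' B B'} {f : A' ⇒♯ A} {g : B ⇒♯ B'} →
                qi ∘♯ ⁇♯ (f ⊸♯ g) ≈♯ (!♯ f ⊸♯ ⁇♯ g) ∘♯ qi
      dm  : ∀ {A B} → (¬ A ⊕ ¬ B) ⇒♯ ¬ (A & B)
      dm⁻ : ∀ {A B} → ¬ (A & B) ⇒♯ (¬ A ⊕ ¬ B)
      dm-isoˡ : ∀ {A B} → dm⁻ {A} {B} ∘♯ dm ≈♯ id♯
      dm-isoʳ : ∀ {A B} → dm {A} {B} ∘♯ dm⁻ ≈♯ id♯
      dm-nat  : ∀ {A A' B B'} {f : A' ⇒♯ A} {g : B' ⇒♯ B} →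
                dm ∘♯ (¬♯ f ⊕♯ ¬♯ g) ≈♯ ¬♯ (f &♯ g) ∘♯ dm
      Υ : ∀ {A} → F₀ (⁇ A) ⇒♯ ⁇ (F₀ A)
      Υ-nat : ∀ {A B} {f : A ⇒♯ B} → Υ ∘♯ !♯ (⁇♯ f) ≈♯ ⁇♯ (!♯ f) ∘♯ Υ
      Υ-η : ∀ {A} → Υ {A} ∘♯ !♯ η♯ ≈♯ η♯
      Υ-μ : ∀ {A} → Υ {A} ∘♯ !♯ μ♯ ≈♯ μ♯ ∘♯ (⁇♯ Υ ∘♯ Υ)
      Υ-ε : ∀ {A} → ⁇♯ ε♯ ∘♯ Υ {A} ≈♯ ε♯
      Υ-δ : ∀ {A} → ⁇♯ δ♯ ∘♯ Υ {A} ≈♯ Υ ∘♯ (!♯ Υ ∘♯ δ♯)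

-- Bi-liberalizable symmetric monoidal closed categories

record BiLSMCC (o ℓ e : Level) : Set (lsuc (o ⊔ ℓ ⊔ e)) where
  field
    nsc      : NSC o ℓ e
    weakCop  : WeakCoproducts (NSC.cat nsc)
    sharp    : SharpSub nsc
    sharpCop : SharpCoproducts nsc weakCop sharp
    fwlPart  : FwLPart nsc weakCop sharp sharpCop
    axioms   : BiAxioms nsc weakCop sharp sharpCop fwlPart

infixr 12 _`⊗_ _`⅋_ _`&_ _`⊕_
infixr 11 _`⊸_

data Formula : Set where
  atom : ℕ → Formula
  `⊤ `⊥ `1 `0 : Formula   -- ⊤ unit of ⊗, ⊥ unit of ⅋, 1 unit of &, 0 unit of ⊕
  _`⊗_ _`⅋_ _`&_ _`⊕_ _`⊸_ : Formula → Formula → Formula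
  `! `? : Formula → Formula

Ctx : Set
Ctx = List Formula

infix 3 _⊢_

data _⊢_ : Ctx → Ctx → Set where
  ax   : ∀ {A} → [ A ] ⊢ [ A ]
  cut⁻ : ∀ {Δ Δ' Γ' B} → Δ ⊢ [ B ] → Δ' ++ [ B ] ⊢ Γ' → Δ ++ Δ' ⊢ Γ'
  exL  : ∀ {Δ Δ' Γ} → Δ ↭ Δ' → Δ ⊢ Γ → Δ' ⊢ Γ
  exR  : ∀ {Δ Γ Γ'} → Γ ↭ Γ' → Δ ⊢ Γ → Δ ⊢ Γ'
  ⊤L   : ∀ {Δ Γ} → Δ ⊢ Γ → Δ ++ [ `⊤ ] ⊢ Γ
  ⊤R   : [] ⊢ [ `⊤ ]
  ⊥L   : [ `⊥ ] ⊢ []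
  ⊥R   : ∀ {Δ Γ} → Δ ⊢ Γ → Δ ⊢ `⊥ ∷ Γ
  ⊗L   : ∀ {Δ Γ A B} → Δ ++ A ∷ B ∷ [] ⊢ Γ → Δ ++ [ A `⊗ B ] ⊢ Γ
  ⊗R⁻  : ∀ {Δ₁ Δ₂ B₁ B₂} → Δ₁ ⊢ [ B₁ ] → Δ₂ ⊢ [ B₂ ] → Δ₁ ++ Δ₂ ⊢ [ B₁ `⊗ B₂ ]
  ⅋L⁻  : ∀ {A₁ A₂ Γ₁ Γ₂} → [ A₁ ] ⊢ Γ₁ → [ A₂ ] ⊢ Γ₂ → [ A₁ `⅋ A₂ ] ⊢ Γ₁ ++ Γ₂
  ⅋R   : ∀ {Δ Γ A B} → Δ ⊢ A ∷ B ∷ Γ → Δ ⊢ (A `⅋ B) ∷ Γ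
  ⊸L   : ∀ {Δ Δ' Γ Γ' A B} → Δ ⊢ A ∷ Γ → Δ' ++ [ B ] ⊢ Γ' →
         (Δ ++ Δ') ++ [ A `⊸ B ] ⊢ Γ ++ Γ'
  ⊸R⁻  : ∀ {Γ A B} → [ A ] ⊢ B ∷ Γ → [] ⊢ (A `⊸ B) ∷ Γ
  1R   : ∀ {Δ Γ} → Δ ⊢ `1 ∷ Γ
  0L   : ∀ {Δ Γ} → Δ ++ [ `0 ] ⊢ Γ
  &L₁  : ∀ {Δ Γ A B} → Δ ++ [ A ] ⊢ Γ → Δ ++ [ A `& B ] ⊢ Γ
  &L₂  : ∀ {Δ Γ A B} → Δ ++ [ B ] ⊢ Γ → Δ ++ [ A `& B ] ⊢ Γ
  &R⁻  : ∀ {Δ A B} → Δ ⊢ [ A ] → Δ ⊢ [ B ] → Δ ⊢ [ A `& B ]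
  ⊕R₁  : ∀ {Δ Γ A B} → Δ ⊢ A ∷ Γ → Δ ⊢ (A `⊕ B) ∷ Γ
  ⊕R₂  : ∀ {Δ Γ A B} → Δ ⊢ B ∷ Γ → Δ ⊢ (A `⊕ B) ∷ Γ
  ⊕L⁻  : ∀ {Γ A B} → [ A ] ⊢ Γ → [ B ] ⊢ Γ → [ A `⊕ B ] ⊢ Γ
  !W   : ∀ {Δ Γ A} → Δ ⊢ Γ → Δ ++ [ `! A ] ⊢ Γ
  ?W   : ∀ {Δ Γ A} → Δ ⊢ Γ → Δ ⊢ `? A ∷ Γ
  !C   : ∀ {Δ Γ A} → Δ ++ `! A ∷ `! A ∷ [] ⊢ Γ → Δ ++ [ `! A ] ⊢ Γ
  ?C   : ∀ {Δ Γ A} → Δ ⊢ `? A ∷ `? A ∷ Γ → Δ ⊢ `? A ∷ Γ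
  !D   : ∀ {Δ Γ A} → Δ ++ [ A ] ⊢ Γ → Δ ++ [ `! A ] ⊢ Γ
  ?D   : ∀ {Δ Γ A} → Δ ⊢ A ∷ Γ → Δ ⊢ `? A ∷ Γ
  !P   : ∀ {Δ Γ A} → map `! Δ ⊢ A ∷ map `? Γ → map `! Δ ⊢ `! A ∷ map `? Γ
  ?P   : ∀ {Δ Γ A} → map `! Δ ++ [ A ] ⊢ map `? Γ → map `! Δ ++ [ `? A ] ⊢ map `? Γ
  dist!? : ∀ {Δ Γ A} → Δ ++ [ `? (`! A) ] ⊢ Γ → Δ ++ [ `! (`? A) ] ⊢ Γ
  dist?! : ∀ {Δ Γ B} → Δ ⊢ `! (`? B) ∷ Γ → Δ ⊢ `? (`! B) ∷ Γ
  distL  : ∀ {Δ Γ A B D} → Δ ++ [ (A `⊗ B) `⅋ D ] ⊢ Γ → Δ ++ A ∷ (B `⅋ D) ∷ [] ⊢ Γ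
  distR  : ∀ {Δ Γ A B D} → Δ ⊢ (A `⊗ (B `⅋ D)) ∷ Γ → Δ ⊢ (A `⊗ B) ∷ D ∷ Γ

module Interp {o ℓ e} (C : BiLSMCC o ℓ e) where
  open BiLSMCC C
  open NSC nsc
  open Category cat
  open BiOps nsc weakCop sharp sharpCop fwlPart public

  ⟦_⟧ : Formula → (ℕ → Obj) → Obj
  ⟦ atom n ⟧ ρ = ρ n
  ⟦ `⊤ ⟧ ρ = Monoidal.unit monoidal
  ⟦ `⊥ ⟧ ρ = ⊥
  ⟦ `1 ⟧ ρ = Products.one products
  ⟦ `0 ⟧ ρ = WeakCoproducts.zero weakCop
  ⟦ A `⊗ B ⟧ ρ = Monoidal._⊗₀_ monoidal (⟦ A ⟧ ρ) (⟦ B ⟧ ρ)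
  ⟦ A `⅋ B ⟧ ρ = ⟦ A ⟧ ρ ⅋ ⟦ B ⟧ ρ
  ⟦ A `& B ⟧ ρ = Products._&_ products (⟦ A ⟧ ρ) (⟦ B ⟧ ρ)
  ⟦ A `⊕ B ⟧ ρ = WeakCoproducts._⊕_ weakCop (⟦ A ⟧ ρ) (⟦ B ⟧ ρ)
  ⟦ A `⊸ B ⟧ ρ = Closed._⊸_ closed (⟦ A ⟧ ρ) (⟦ B ⟧ ρ)
  ⟦ `! A ⟧ ρ = Comonad.F₀ bang (⟦ A ⟧ ρ)
  ⟦ `? A ⟧ ρ = ⁇ (⟦ A ⟧ ρ)

  ⊗⟦_⟧ : Ctx → (ℕ → Obj) → Obj
  ⊗⟦ [] ⟧ ρ = Monoidal.unit monoidal
  ⊗⟦ A ∷ [] ⟧ ρ = ⟦ A ⟧ ρ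
  ⊗⟦ A ∷ B ∷ Δ ⟧ ρ = Monoidal._⊗₀_ monoidal (⟦ A ⟧ ρ) (⊗⟦ B ∷ Δ ⟧ ρ)

  ⅋⟦_⟧ : Ctx → (ℕ → Obj) → Obj
  ⅋⟦ [] ⟧ ρ = ⊥
  ⅋⟦ A ∷ [] ⟧ ρ = ⟦ A ⟧ ρ
  ⅋⟦ A ∷ B ∷ Γ ⟧ ρ = ⟦ A ⟧ ρ ⅋ ⅋⟦ B ∷ Γ ⟧ ρ

module Submission where

open import Data.Nat using (ℕ)
open import Data.Product using (_,_; proj₁; proj₂)
open import Data.List using ([]; _∷_; _++_; [_]; map)
open import Data.List.Relation.Binary.Permutation.Propositional
  using (_↭_; refl; prep; swap; trans; ↭-sym)
open import Defs

-- Every rule is interpreted by a structure map of ♯C.  Evaluation and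
-- currying of C need not be sharp; they are rebuilt from  A ⊸ B ≅ ¬A ⅋ B,
-- and the linear distributivity Ω composes a map into A ⅋ Q with one out
-- of Y ⊗ A.  For the exponential rules the liberalizing isomorphisms turn
-- a !-context into !(A₁ & … & Aₘ) and a ?-context into ?(B₁ ⊕ … ⊕ Bₙ);
-- promotion is then δ followed by Σ, and ?-promotion is the Kleisli
-- extension of ? transported along  ?(A ⊸ B) ≅ !A ⊸ ?B.

module SharpStructure {o ℓ e} (C : BiLSMCC o ℓ e) where
  open BiLSMCC C
  open NSC nsc using (monoidal; symm; closed)
  open Monoidal monoidal using (_⊗₀_; unit)
  open Closed closed using (_⊸_; ev; Λ)
  open SharpSub sharp
  open FwLPart fwlPart
  open BiAxioms axioms
  open Comonad (NSC.bang nsc) using (F₀)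
  open Interp C using (_⇒♯_; _∘♯_; id♯; _⊗♯_; _⅋_; _⅋♯_; ⊥; ¬; ⁇; ⁇♯; μ♯)

  module ⊗ = Monoidal monoidal
  module ⅋ = Monoidal par

  α⇒♯ : ∀ {A B D} → ((A ⊗₀ B) ⊗₀ D) ⇒♯ (A ⊗₀ (B ⊗₀ D))
  α⇒♯ = ⊗.α⇒ , ♯-α⇒

  α⇐♯ : ∀ {A B D} → (A ⊗₀ (B ⊗₀ D)) ⇒♯ ((A ⊗₀ B) ⊗₀ D)
  α⇐♯ = ⊗.α⇐ , ♯-α⇐

  l⇒♯ : ∀ {A} → (unit ⊗₀ A) ⇒♯ A
  l⇒♯ = ⊗.l⇒ , ♯-l⇒

  l⇐♯ : ∀ {A} → A ⇒♯ (unit ⊗₀ A)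
  l⇐♯ = ⊗.l⇐ , ♯-l⇐

  r⇒♯ : ∀ {A} → (A ⊗₀ unit) ⇒♯ A
  r⇒♯ = ⊗.r⇒ , ♯-r⇒

  r⇐♯ : ∀ {A} → A ⇒♯ (A ⊗₀ unit)
  r⇐♯ = ⊗.r⇐ , ♯-r⇐

  σ♯ : ∀ {A B} → (A ⊗₀ B) ⇒♯ (B ⊗₀ A)
  σ♯ = Symmetric.σ symm , ♯-σ

  -- ⅋ is the tensor of (♯C)^op, so its structure maps are read backwards.
  ⅋-α⇒ : ∀ {A B D} → ((A ⅋ B) ⅋ D) ⇒♯ (A ⅋ (B ⅋ D))
  ⅋-α⇒ = ⅋.α⇐

  ⅋-α⇐ : ∀ {A B D} → (A ⅋ (B ⅋ D)) ⇒♯ ((A ⅋ B) ⅋ D)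
  ⅋-α⇐ = ⅋.α⇒

  ⅋-l⇒ : ∀ {A} → (⊥ ⅋ A) ⇒♯ A
  ⅋-l⇒ = ⅋.l⇐

  ⅋-l⇐ : ∀ {A} → A ⇒♯ (⊥ ⅋ A)
  ⅋-l⇐ = ⅋.l⇒

  ⅋-r⇒ : ∀ {A} → (A ⅋ ⊥) ⇒♯ A
  ⅋-r⇒ = ⅋.r⇐

  ⅋-r⇐ : ∀ {A} → A ⇒♯ (A ⅋ ⊥)
  ⅋-r⇐ = ⅋.r⇒

  ⅋-σ : ∀ {A B} → (A ⅋ B) ⇒♯ (B ⅋ A)
  ⅋-σ = Symmetric.σ parSym

  Ω-cut : ∀ {X Y A Q R} → X ⇒♯ (A ⅋ Q) → (Y ⊗₀ A) ⇒♯ R → (Y ⊗₀ X) ⇒♯ (R ⅋ Q)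
  Ω-cut f g = (g ⅋♯ id♯) ∘♯ Ω ∘♯ (id♯ ⊗♯ f)

  -- The next two maps are sharp because ♯C(A, ⊥) = C(A, ⊥) and ♯C(⊤, B) = C(⊤, B).
  ¬-ev♯ : ∀ {A} → (¬ A ⊗₀ A) ⇒♯ ⊥
  ¬-ev♯ = ev , ♯-into-⊥ ev

  ¬-coev♯ : ∀ {A} → unit ⇒♯ (¬ A ⅋ A)
  ¬-coev♯ = ln ∘♯ (Λ ⊗.l⇒ , ♯-from-⊤ (Λ ⊗.l⇒))

  ev♯ : ∀ {A B} → ((A ⊸ B) ⊗₀ A) ⇒♯ B
  ev♯ = ⅋-l⇒ ∘♯ Ω-cut ln (¬-ev♯ ∘♯ σ♯) ∘♯ σ♯

  Λ♯ : ∀ {X A B} → (X ⊗₀ A) ⇒♯ B → X ⇒♯ (A ⊸ B)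
  Λ♯ f = ln⁻ ∘♯ ⅋-σ ∘♯ Ω-cut (⅋-σ ∘♯ ¬-coev♯) f ∘♯ r⇐♯

  !⊗⁇-extend : ∀ {D A Q} → (F₀ D ⊗₀ A) ⇒♯ ⁇ Q → (F₀ D ⊗₀ ⁇ A) ⇒♯ ⁇ Q
  !⊗⁇-extend f = ev♯ ∘♯ ((qi ∘♯ μ♯ ∘♯ ⁇♯ (qi⁻ ∘♯ Λ♯ (f ∘♯ σ♯))) ⊗♯ id♯) ∘♯ σ♯

module Semantics {o ℓ e} (C : BiLSMCC o ℓ e) (ρ : ℕ → Category.Obj (NSC.cat (BiLSMCC.nsc C))) where
  open BiLSMCC C
  open Interp C
  open NSC nsc using (monoidal; products; bang; liberal)
  open Category (NSC.cat nsc) using (Obj)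
  open Monoidal monoidal using (_⊗₀_; unit)
  open Products products using (one; _&_; π₁; π₂; ⟨_,_⟩; !)
  open WeakCoproducts weakCop using (zero; _⊕_; inj₁; inj₂)
  open Comonad bang using (F₀)
  open SharpSub sharp
  open SharpCoproducts sharpCop
  open FwLPart fwlPart
  open BiAxioms axioms
  open SharpStructure C
  module ! = Liberal liberal
  module ⁇ = Liberal fwl

  ⟪_⟫ : Formula → Obj
  ⟪ A ⟫ = ⟦ A ⟧ ρ

  -- Unlike ⊗⟦_⟧ and ⅋⟦_⟧, these always end in the unit, so that
  -- concatenation of contexts is handled by structural recursion.
  ⊗ₗ : Ctx → Obj
  ⊗ₗ [] = unit
  ⊗ₗ (A ∷ Δ) = ⟪ A ⟫ ⊗₀ ⊗ₗ Δ

  ⅋ₗ : Ctx → Obj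
  ⅋ₗ [] = ⊥
  ⅋ₗ (A ∷ Γ) = ⟪ A ⟫ ⅋ ⅋ₗ Γ

  &ₗ : Ctx → Obj
  &ₗ [] = one
  &ₗ (A ∷ Δ) = ⟪ A ⟫ & &ₗ Δ

  ⊕ₗ : Ctx → Obj
  ⊕ₗ [] = zero
  ⊕ₗ (A ∷ Γ) = ⟪ A ⟫ ⊕ ⊕ₗ Γ

  ⊗⟦⟧⇒⊗ₗ : ∀ Δ → ⊗⟦ Δ ⟧ ρ ⇒♯ ⊗ₗ Δ
  ⊗⟦⟧⇒⊗ₗ [] = id♯
  ⊗⟦⟧⇒⊗ₗ (A ∷ []) = r⇐♯
  ⊗⟦⟧⇒⊗ₗ (A ∷ B ∷ Δ) = id♯ ⊗♯ ⊗⟦⟧⇒⊗ₗ (B ∷ Δ)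

  ⅋ₗ⇒⅋⟦⟧ : ∀ Γ → ⅋ₗ Γ ⇒♯ ⅋⟦ Γ ⟧ ρ
  ⅋ₗ⇒⅋⟦⟧ [] = id♯
  ⅋ₗ⇒⅋⟦⟧ (A ∷ []) = ⅋-r⇒
  ⅋ₗ⇒⅋⟦⟧ (A ∷ B ∷ Γ) = id♯ ⅋♯ ⅋ₗ⇒⅋⟦⟧ (B ∷ Γ)

  ⊗ₗ-split : ∀ Δ Δ' → ⊗ₗ (Δ ++ Δ') ⇒♯ (⊗ₗ Δ ⊗₀ ⊗ₗ Δ')
  ⊗ₗ-split [] Δ' = l⇐♯
  ⊗ₗ-split (A ∷ Δ) Δ' = α⇐♯ ∘♯ (id♯ ⊗♯ ⊗ₗ-split Δ Δ')

  ⊗ₗ-join : ∀ Δ Δ' → (⊗ₗ Δ ⊗₀ ⊗ₗ Δ') ⇒♯ ⊗ₗ (Δ ++ Δ')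
  ⊗ₗ-join [] Δ' = l⇒♯
  ⊗ₗ-join (A ∷ Δ) Δ' = (id♯ ⊗♯ ⊗ₗ-join Δ Δ') ∘♯ α⇒♯

  ⅋ₗ-join : ∀ Γ Γ' → (⅋ₗ Γ ⅋ ⅋ₗ Γ') ⇒♯ ⅋ₗ (Γ ++ Γ')
  ⅋ₗ-join [] Γ' = ⅋-l⇒
  ⅋ₗ-join (A ∷ Γ) Γ' = (id♯ ⅋♯ ⅋ₗ-join Γ Γ') ∘♯ ⅋-α⇒

  ⊗ₗ-splitLast : ∀ Δ {A} → ⊗ₗ (Δ ++ [ A ]) ⇒♯ (⊗ₗ Δ ⊗₀ ⟪ A ⟫)
  ⊗ₗ-splitLast Δ = (id♯ ⊗♯ r⇒♯) ∘♯ ⊗ₗ-split Δ _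

  ⊗ₗ-joinLast : ∀ Δ {A} → (⊗ₗ Δ ⊗₀ ⟪ A ⟫) ⇒♯ ⊗ₗ (Δ ++ [ A ])
  ⊗ₗ-joinLast Δ = ⊗ₗ-join Δ _ ∘♯ (id♯ ⊗♯ r⇐♯)

  ⊗ₗ-onSuffix : ∀ Δ {Σ Σ'} → ⊗ₗ Σ ⇒♯ ⊗ₗ Σ' → ⊗ₗ (Δ ++ Σ) ⇒♯ ⊗ₗ (Δ ++ Σ')
  ⊗ₗ-onSuffix Δ {Σ} {Σ'} f = ⊗ₗ-join Δ Σ' ∘♯ (id♯ ⊗♯ f) ∘♯ ⊗ₗ-split Δ Σ

  ⊗ₗ-perm : ∀ {Δ Δ'} → Δ ↭ Δ' → ⊗ₗ Δ ⇒♯ ⊗ₗ Δ'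
  ⊗ₗ-perm refl = id♯
  ⊗ₗ-perm (prep A p) = id♯ ⊗♯ ⊗ₗ-perm p
  ⊗ₗ-perm (swap A B p) = α⇒♯ ∘♯ (σ♯ ⊗♯ ⊗ₗ-perm p) ∘♯ α⇐♯
  ⊗ₗ-perm (trans p q) = ⊗ₗ-perm q ∘♯ ⊗ₗ-perm p

  ⅋ₗ-perm : ∀ {Γ Γ'} → Γ ↭ Γ' → ⅋ₗ Γ ⇒♯ ⅋ₗ Γ'
  ⅋ₗ-perm refl = id♯
  ⅋ₗ-perm (prep A p) = id♯ ⅋♯ ⅋ₗ-perm p
  ⅋ₗ-perm (swap A B p) = ⅋-α⇒ ∘♯ (⅋-σ ⅋♯ ⅋ₗ-perm p) ∘♯ ⅋-α⇐
  ⅋ₗ-perm (trans p q) = ⅋ₗ-perm q ∘♯ ⅋ₗ-perm p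

  ⊗ₗ-!⇒!&ₗ : ∀ Δ → ⊗ₗ (map `! Δ) ⇒♯ F₀ (&ₗ Δ)
  ⊗ₗ-!⇒!&ₗ [] = !.m₀ , ♯-m₀
  ⊗ₗ-!⇒!&ₗ (A ∷ Δ) = (!.m , ♯-m) ∘♯ (id♯ ⊗♯ ⊗ₗ-!⇒!&ₗ Δ)

  !&ₗ⇒⊗ₗ-! : ∀ Δ → F₀ (&ₗ Δ) ⇒♯ ⊗ₗ (map `! Δ)
  !&ₗ⇒⊗ₗ-! [] = !.m₀⁻ , ♯-m₀⁻
  !&ₗ⇒⊗ₗ-! (A ∷ Δ) = (id♯ ⊗♯ !&ₗ⇒⊗ₗ-! Δ) ∘♯ (!.m⁻ , ♯-m⁻)

  ⅋ₗ-?⇒?⊕ₗ : ∀ Γ → ⅋ₗ (map `? Γ) ⇒♯ ⁇ (⊕ₗ Γ)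
  ⅋ₗ-?⇒?⊕ₗ [] = ⁇.m₀⁻
  ⅋ₗ-?⇒?⊕ₗ (A ∷ Γ) = ⁇.m⁻ ∘♯ (id♯ ⅋♯ ⅋ₗ-?⇒?⊕ₗ Γ)

  ?⊕ₗ⇒⅋ₗ-? : ∀ Γ → ⁇ (⊕ₗ Γ) ⇒♯ ⅋ₗ (map `? Γ)
  ?⊕ₗ⇒⅋ₗ-? [] = ⁇.m₀
  ?⊕ₗ⇒⅋ₗ-? (A ∷ Γ) = (id♯ ⅋♯ ?⊕ₗ⇒⅋ₗ-? Γ) ∘♯ ⁇.m

  ♯⟨_,_⟩ : ∀ {X A B} → X ⇒♯ A → X ⇒♯ B → X ⇒♯ (A & B)
  ♯⟨ f , g ⟩ = ⟨ proj₁ f , proj₁ g ⟩ , ♯-⟨⟩ (proj₂ f) (proj₂ g)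

  !-diag♯ : ∀ {A} → F₀ A ⇒♯ (F₀ A ⊗₀ F₀ A)
  !-diag♯ = (!.m⁻ , ♯-m⁻) ∘♯ !♯ ♯⟨ id♯ , id♯ ⟩

  ⁇-codiag♯ : ∀ {A} → (⁇ A ⅋ ⁇ A) ⇒♯ ⁇ A
  ⁇-codiag♯ = ⁇♯ (♯copair id♯ id♯) ∘♯ ⁇.m⁻

  ⟦_⟧⊢ : ∀ {Δ Γ} → Δ ⊢ Γ → ⊗ₗ Δ ⇒♯ ⅋ₗ Γ
  ⟦ ax ⟧⊢ = ⅋-r⇐ ∘♯ r⇒♯
  ⟦ cut⁻ {Δ} {Δ'} d e ⟧⊢ =
    ⟦ e ⟧⊢ ∘♯ ⊗ₗ-joinLast Δ' ∘♯ σ♯ ∘♯ ((⅋-r⇒ ∘♯ ⟦ d ⟧⊢) ⊗♯ id♯) ∘♯ ⊗ₗ-split Δ Δ'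
  ⟦ exL p d ⟧⊢ = ⟦ d ⟧⊢ ∘♯ ⊗ₗ-perm (↭-sym p)
  ⟦ exR p d ⟧⊢ = ⅋ₗ-perm p ∘♯ ⟦ d ⟧⊢
  ⟦ ⊤L {Δ} d ⟧⊢ = ⟦ d ⟧⊢ ∘♯ r⇒♯ ∘♯ (id♯ ⊗♯ ⊤-term) ∘♯ ⊗ₗ-splitLast Δ
  ⟦ ⊤R ⟧⊢ = ⅋-r⇐
  ⟦ ⊥L ⟧⊢ = r⇒♯
  ⟦ ⊥R d ⟧⊢ = ⅋-l⇐ ∘♯ ⟦ d ⟧⊢
  ⟦ ⊗L {Δ} d ⟧⊢ = ⟦ d ⟧⊢ ∘♯ ⊗ₗ-onSuffix Δ α⇒♯
  ⟦ ⊗R⁻ {Δ₁} {Δ₂} d₁ d₂ ⟧⊢ =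
    ⅋-r⇐ ∘♯ ((⅋-r⇒ ∘♯ ⟦ d₁ ⟧⊢) ⊗♯ (⅋-r⇒ ∘♯ ⟦ d₂ ⟧⊢)) ∘♯ ⊗ₗ-split Δ₁ Δ₂
  ⟦ ⅋L⁻ {Γ₁ = Γ₁} {Γ₂ = Γ₂} d₁ d₂ ⟧⊢ =
    ⅋ₗ-join Γ₁ Γ₂ ∘♯ ((⟦ d₁ ⟧⊢ ∘♯ r⇐♯) ⅋♯ (⟦ d₂ ⟧⊢ ∘♯ r⇐♯)) ∘♯ r⇒♯
  ⟦ ⅋R d ⟧⊢ = ⅋-α⇐ ∘♯ ⟦ d ⟧⊢
  ⟦ ⊸L {Δ} {Δ'} {Γ} {Γ'} d e ⟧⊢ =
    ⅋ₗ-join Γ Γ' ∘♯ ⅋-σ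
    ∘♯ Ω-cut (Ω-cut ⟦ d ⟧⊢ ev♯) (⟦ e ⟧⊢ ∘♯ ⊗ₗ-joinLast Δ')
    ∘♯ (id♯ ⊗♯ σ♯) ∘♯ α⇒♯ ∘♯ (σ♯ ⊗♯ id♯) ∘♯ (⊗ₗ-split Δ Δ' ⊗♯ id♯)
    ∘♯ ⊗ₗ-splitLast (Δ ++ Δ')
  ⟦ ⊸R⁻ d ⟧⊢ = (ln⁻ ⅋♯ id♯) ∘♯ ⅋-α⇐ ∘♯ ln ∘♯ Λ♯ (⟦ d ⟧⊢ ∘♯ σ♯)
  ⟦ 1R ⟧⊢ = ⅋-σ ∘♯ (id♯ ⅋♯ (! , ♯-!)) ∘♯ pt⁻ ∘♯ ⊤-term
  -- 0 ⊗ X need not be initial, but 0 is initial in ♯C and maps to X ⊸ Q.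
  ⟦ 0L {Δ} ⟧⊢ = ev♯ ∘♯ (♯¡ ⊗♯ id♯) ∘♯ σ♯ ∘♯ ⊗ₗ-splitLast Δ
  ⟦ &L₁ {Δ} d ⟧⊢ = ⟦ d ⟧⊢ ∘♯ ⊗ₗ-onSuffix Δ ((π₁ , ♯-π₁) ⊗♯ id♯)
  ⟦ &L₂ {Δ} d ⟧⊢ = ⟦ d ⟧⊢ ∘♯ ⊗ₗ-onSuffix Δ ((π₂ , ♯-π₂) ⊗♯ id♯)
  ⟦ &R⁻ d₁ d₂ ⟧⊢ = ⅋-r⇐ ∘♯ ♯⟨ ⅋-r⇒ ∘♯ ⟦ d₁ ⟧⊢ , ⅋-r⇒ ∘♯ ⟦ d₂ ⟧⊢ ⟩
  ⟦ ⊕R₁ d ⟧⊢ = ((inj₁ , ♯-inj₁) ⅋♯ id♯) ∘♯ ⟦ d ⟧⊢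
  ⟦ ⊕R₂ d ⟧⊢ = ((inj₂ , ♯-inj₂) ⅋♯ id♯) ∘♯ ⟦ d ⟧⊢
  ⟦ ⊕L⁻ d₁ d₂ ⟧⊢ = ♯copair (⟦ d₁ ⟧⊢ ∘♯ r⇐♯) (⟦ d₂ ⟧⊢ ∘♯ r⇐♯) ∘♯ r⇒♯
  ⟦ !W {Δ} d ⟧⊢ = ⟦ d ⟧⊢ ∘♯ r⇒♯ ∘♯ (id♯ ⊗♯ ⊤-term) ∘♯ ⊗ₗ-splitLast Δ
  ⟦ ?W d ⟧⊢ = (⊥-init ⅋♯ id♯) ∘♯ ⅋-l⇐ ∘♯ ⟦ d ⟧⊢
  ⟦ !C {Δ} d ⟧⊢ = ⟦ d ⟧⊢ ∘♯ ⊗ₗ-onSuffix Δ ((id♯ ⊗♯ r⇐♯) ∘♯ !-diag♯ ∘♯ r⇒♯)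
  ⟦ ?C d ⟧⊢ = (⁇-codiag♯ ⅋♯ id♯) ∘♯ ⅋-α⇐ ∘♯ ⟦ d ⟧⊢
  ⟦ !D {Δ} d ⟧⊢ = ⟦ d ⟧⊢ ∘♯ ⊗ₗ-onSuffix Δ (ε♯ ⊗♯ id♯)
  ⟦ ?D d ⟧⊢ = (η♯ ⅋♯ id♯) ∘♯ ⟦ d ⟧⊢
  ⟦ !P {Δ} {Γ} d ⟧⊢ =
    (id♯ ⅋♯ ?⊕ₗ⇒⅋ₗ-? Γ) ∘♯ Sig
    ∘♯ !♯ ((id♯ ⅋♯ ⅋ₗ-?⇒?⊕ₗ Γ) ∘♯ ⟦ d ⟧⊢ ∘♯ !&ₗ⇒⊗ₗ-! Δ) ∘♯ δ♯
    ∘♯ ⊗ₗ-!⇒!&ₗ Δ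
  ⟦ ?P {Δ} {Γ} d ⟧⊢ =
    ?⊕ₗ⇒⅋ₗ-? Γ
    ∘♯ !⊗⁇-extend (⅋ₗ-?⇒?⊕ₗ Γ ∘♯ ⟦ d ⟧⊢ ∘♯ ⊗ₗ-joinLast (map `! Δ) ∘♯ (!&ₗ⇒⊗ₗ-! Δ ⊗♯ id♯))
    ∘♯ (⊗ₗ-!⇒!&ₗ Δ ⊗♯ id♯) ∘♯ ⊗ₗ-splitLast (map `! Δ)
  ⟦ dist!? {Δ} d ⟧⊢ = ⟦ d ⟧⊢ ∘♯ ⊗ₗ-onSuffix Δ (Υ ⊗♯ id♯)
  ⟦ dist?! d ⟧⊢ = (Υ ⅋♯ id♯) ∘♯ ⟦ d ⟧⊢
  ⟦ distL {Δ} d ⟧⊢ = ⟦ d ⟧⊢ ∘♯ ⊗ₗ-onSuffix Δ ((Ω ⊗♯ id♯) ∘♯ α⇐♯)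
  ⟦ distR d ⟧⊢ = ⅋-α⇒ ∘♯ (Ω ⅋♯ id♯) ∘♯ ⟦ d ⟧⊢

mainTheorem4 : ∀ {o ℓ e} (C : BiLSMCC o ℓ e) (ρ : ℕ → Category.Obj (NSC.cat (BiLSMCC.nsc C))) {Δ Γ : Ctx} →
    Δ ⊢ Γ → Interp._⇒♯_ C (Interp.⊗⟦_⟧ C Δ ρ) (Interp.⅋⟦_⟧ C Γ ρ)
mainTheorem4 C ρ {Δ} {Γ} d = ⅋ₗ⇒⅋⟦⟧ Γ ∘♯ ⟦ d ⟧⊢ ∘♯ ⊗⟦⟧⇒⊗ₗ Δ
  where open Interp C using (_∘♯_)
        open Semantics C ρ
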